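{- For every binary tree pattern $t$, the generating function $g_t(x)$ is a rational function of $x$.
   Context: All trees are full binary trees: rooted, ordered (plane) trees in which every vertex has either $0$ children (a leaf) or exactly $2$ ordered children (left and right). A binary tree pattern is such a tree. A tree $T$ contains a pattern $t$ (non-contiguously) if there is a tree $T^*$ obtained from $T$ by a finite sequence of edge contractions such that $t$ is a contiguous, rooted, ordered subtree of $T^*$; concretely, there is an injective map $\varphi$ from the vertices of $t$ to those of $T$ such that for every internal vertex $u$ of $t$ with left child $u_1$ and right child $u_2$, $\varphi(u_1)$ lies in the subtree rooted at the left child of $\varphi(u)$ and $\varphi(u_2)$ lies in the subtree rooted at the right child of $\varphi(u)$. Otherwise $T$ avoids $t$. Let $\mathrm{av}_t(n)$ be the number of binary trees with $n$ leaves avoiding $t$, with $\mathrm{av}_t(0)=0$, and $g_t(x)=\sum_{n\ge 0}\mathrm{av}_t(n)x^n$. -}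

module Defs where

open import Data.Nat using (ℕ; zero; suc; _+_; _≟_)
open import Data.List using (List; []; _∷_; _++_; length; filter; concatMap; map)
open import Data.Product using (Σ; ∃; _×_; _,_)
open import Data.Sum using (_⊎_; inj₁; inj₂)
open import Data.Unit using (⊤; tt)
open import Data.Empty using (⊥)
open import Data.Integer using (+_)
open import Data.Rational using (ℚ; 0ℚ; _/_; _*_) renaming (_+_ to _+ℚ_)
open import Data.List.Relation.Unary.Any using (Any)
open import Relation.Nullary using (Dec; yes; no; ¬_)
open import Relation.Nullary.Decidable using (_×-dec_; _⊎-dec_; ¬?)
open import Relation.Binary.PropositionalEquality using (_≡_; _≢_)

data Tree : Set where
  leaf : Tree
  node : Tree → Tree → Tree

leaves : Tree → ℕ
leaves leaf = 1
leaves (node l r) = leaves l + leaves r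

-- s ⊑ T : s is the subtree of T rooted at some vertex of T (the vertices of T
-- correspond to these occurrences).
data _⊑_ : Tree → Tree → Set where
  here : ∀ {T} → T ⊑ T
  inl  : ∀ {s l r} → s ⊑ l → s ⊑ node l r
  inr  : ∀ {s l r} → s ⊑ r → s ⊑ node l r

-- Emb t v : there is a map φ from vertices of t into (the subtree at) the vertex v
-- with φ(root t) = v, such that for every internal vertex u of t with children
-- u₁,u₂, φ(u₁) lies in the subtree at the left child of φ(u) and φ(u₂) in the
-- subtree at the right child of φ(u).  (Injectivity is automatic.)
Emb : Tree → Tree → Set
Emb leaf v = ⊤
Emb (node t₁ t₂) leaf = ⊥
Emb (node t₁ t₂) (node l r) = (Σ Tree λ s → s ⊑ l × Emb t₁ s) × (Σ Tree λ s → s ⊑ r × Emb t₂ s)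

-- T contains the pattern t (non-contiguously): φ(root t) may be any vertex of T.
Contains : Tree → Tree → Set
Contains T t = Σ Tree λ s → s ⊑ T × Emb t s

Avoids : Tree → Tree → Set
Avoids T t = ¬ Contains T t

anySub? : {P : Tree → Set} → (∀ s → Dec (P s)) → ∀ T → Dec (Σ Tree λ s → s ⊑ T × P s)
anySub? {P} P? leaf with P? leaf
... | yes p = yes (leaf , here , p)
... | no ¬p = no λ { (.leaf , here , p) → ¬p p }
anySub? {P} P? (node l r) with P? (node l r) | anySub? P? l | anySub? P? r
... | yes p | _ | _ = yes (node l r , here , p)
... | no _ | yes (s , s⊑ , p) | _ = yes (s , inl s⊑ , p)
... | no _ | no _ | yes (s , s⊑ , p) = yes (s , inr s⊑ , p)
... | no ¬p | no ¬a | no ¬b = no λ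
  { (.(node l r) , here , p) → ¬p p
  ; (s , inl s⊑ , p) → ¬a (s , s⊑ , p)
  ; (s , inr s⊑ , p) → ¬b (s , s⊑ , p) }

emb? : ∀ t v → Dec (Emb t v)
emb? leaf v = yes tt
emb? (node t₁ t₂) leaf = no λ ()
emb? (node t₁ t₂) (node l r) = anySub? (emb? t₁) l ×-dec anySub? (emb? t₂) r

contains? : ∀ T t → Dec (Contains T t)
contains? T t = anySub? (emb? t) T

avoids? : ∀ T t → Dec (Avoids T t)
avoids? T t = ¬? (contains? T t)

treesOfHeight≤ : ℕ → List Tree
treesOfHeight≤ zero = leaf ∷ []
treesOfHeight≤ (suc d) =
  leaf ∷ concatMap (λ a → map (node a) (treesOfHeight≤ d)) (treesOfHeight≤ d)

-- All full binary trees with exactly n leaves, each listed exactly once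
-- (a tree with n leaves has height ≤ n).
trees : ℕ → List Tree
trees n = filter (λ T → leaves T ≟ n) (treesOfHeight≤ n)

-- av_t(n): number of binary trees with n leaves avoiding t (av_t(0) = 0).
av : Tree → ℕ → ℕ
av t n = length (filter (λ T → avoids? T t) (trees n))

-- Rational power series: a formal power series Σ aₙ xⁿ (aₙ ∈ ℕ ⊆ ℚ) equals P/Q
-- for polynomials P, Q ∈ ℚ[x] with Q ≠ 0, i.e. Q · (Σ aₙ xⁿ) = P.
-- Polynomials are coefficient lists [c₀, c₁, …].
toℚ : ℕ → ℚ
toℚ n = + n / 1

coeff : List ℚ → ℕ → ℚ
coeff [] n = 0ℚ
coeff (c ∷ cs) zero = c
coeff (c ∷ cs) (suc n) = coeff cs n

mulCoeff : List ℚ → (ℕ → ℕ) → ℕ → ℚ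
mulCoeff [] a n = 0ℚ
mulCoeff (q ∷ qs) a zero = q * toℚ (a zero)
mulCoeff (q ∷ qs) a (suc n) = q * toℚ (a (suc n)) +ℚ mulCoeff qs a n

IsRationalGF : (ℕ → ℕ) → Set
IsRationalGF a =
  Σ (List ℚ) λ P → Σ (List ℚ) λ Q →
    Any (λ c → c ≢ 0ℚ) Q × (∀ n → mulCoeff Q a n ≡ coeff P n)

module Submission where

-- Attach to every tree T its *type* with respect to t: one bit for every
-- internal vertex of t, recording whether T contains the subpattern rooted
-- there.  The type of node l r is a function `combine` of the types of l and
-- r, and T avoids t iff the root bit of its type is false.  Hence the
-- generating series f τ of the trees of type τ satisfy the polynomial system
--   f τ = [type of leaf = τ]·x + Σ_{combine σ ρ = τ} f σ · f ρ.
-- Combining only switches bits on, so σ, ρ ≤ τ (bitwise) in every summand,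
-- and for a type with root bit false, combine τ τ ≠ τ.  So for such τ the
-- equation reads f τ = L + f τ · G with L, G built from types of smaller
-- weight, and G(0) = 0; solving it shows, by induction on the weight, that
-- every f τ is rational, hence so is the sum of those with root bit false.

open import Defs
open import Data.Bool using (Bool; true; false; _∧_; _∨_; not)
open import Data.Bool.Properties using () renaming (_≟_ to _≟ᵇ_)
open import Data.Nat as ℕ using (ℕ; zero; suc; z≤n; s≤s)
import Data.Nat.Properties as ℕP
import Data.Nat.Coprimality as Coprimality
import Data.Integer as ℤ
import Data.Integer.Properties as ℤP
open import Data.Integer using (+_)
open import Data.Rational as Q using (ℚ; mkℚ; _/_; 0ℚ; 1ℚ)
import Data.Rational.Properties as QP
open import Data.Rational.Solver using (module +-*-Solver)
open import Data.List using (List; []; _∷_; _++_; length; filter; concatMap; map)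
open import Data.List.Relation.Unary.Any using (here)
open import Data.Product using (Σ; _×_; _,_; proj₁; proj₂)
open import Data.Sum using (_⊎_; inj₁; inj₂)
open import Data.Unit using (⊤; tt)
open import Data.Empty using (⊥-elim)
open import Function.Bundles using (_⇔_; mk⇔)
open import Relation.Nullary using (Dec; yes; no; does)
open import Relation.Nullary.Decidable using (dec-true; dec-false; does-⇔; map′; _×-dec_; _⊎-dec_)
open import Relation.Unary using (Decidable)
open import Relation.Binary.PropositionalEquality
import Relation.Binary.Reasoning.Setoid as SetoidReasoning

open +-*-Solver

private
  variable
    A B : Set

toℚ-+ : ∀ m n → toℚ (m ℕ.+ n) ≡ toℚ m Q.+ toℚ n
toℚ-+ m n = sym (trans (cong₂ Q._+_ (asFraction m) (asFraction n))
  (cong (λ z → z / 1) (cong₂ ℤ._+_ (ℤP.*-identityʳ (+ m)) (ℤP.*-identityʳ (+ n)))))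
  where
  asFraction : ∀ k → toℚ k ≡ mkℚ (+ k) 0 (Coprimality.sym (Coprimality.1-coprimeTo k))
  asFraction k = QP.normalize-coprime _

*-≢0 : ∀ {x y} → x ≢ 0ℚ → y ≢ 0ℚ → x Q.* y ≢ 0ℚ
*-≢0 {x} {y} x≢0 y≢0 xy≡0 = y≢0 (begin
    y                      ≡⟨ sym (QP.*-identityˡ y) ⟩
    1ℚ Q.* y               ≡⟨ cong (Q._* y) (sym (QP.*-inverseˡ x)) ⟩
    (Q.1/ x Q.* x) Q.* y   ≡⟨ QP.*-assoc (Q.1/ x) x y ⟩
    Q.1/ x Q.* (x Q.* y)   ≡⟨ cong (Q.1/ x Q.*_) xy≡0 ⟩
    Q.1/ x Q.* 0ℚ          ≡⟨ QP.*-zeroʳ (Q.1/ x) ⟩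
    0ℚ                     ∎)
  where
  open ≡-Reasoning
  instance _ = Q.≢-nonZero x≢0

ι : Bool → ℚ
ι true = 1ℚ
ι false = 0ℚ

𝟙 : {P : Set} → Dec P → ℚ
𝟙 d = ι (does d)

*-vanishes : ∀ c {x} → x ≡ 0ℚ → c Q.* x ≡ 0ℚ
*-vanishes c refl = QP.*-zeroʳ c

ι-∧ : ∀ b c q → ι (b ∧ c) Q.* q ≡ ι b Q.* (ι c Q.* q)
ι-∧ true c q = sym (QP.*-identityˡ (ι c Q.* q))
ι-∧ false c q = trans (QP.*-zeroˡ q) (sym (QP.*-zeroˡ (ι c Q.* q)))

Series : Set
Series = ℕ → ℚ

module ≗-Reasoning = SetoidReasoning (ℕ →-setoid ℚ)

infixl 6 _+ₛ_
infixr 7 _·ₛ_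
infixl 7 _*ₛ_

0ₛ : Series
0ₛ _ = 0ℚ

1ₛ : Series
1ₛ zero = 1ℚ
1ₛ (suc _) = 0ℚ

_+ₛ_ : Series → Series → Series
(a +ₛ b) n = a n Q.+ b n

_·ₛ_ : ℚ → Series → Series
(c ·ₛ a) n = c Q.* a n

shift : Series → Series
shift a n = a (suc n)

-- Cauchy product: (a * b)ₙ = Σ_{i+j=n} aᵢ bⱼ.
_*ₛ_ : Series → Series → Series
(a *ₛ b) zero = a 0 Q.* b 0
(a *ₛ b) (suc n) = a 0 Q.* b (suc n) Q.+ (shift a *ₛ b) n

monomial : ℕ → Series
monomial k n = ι (k ℕ.≡ᵇ n)

+ₛ-cong : ∀ {a a' b b'} → a ≗ a' → b ≗ b' → a +ₛ b ≗ a' +ₛ b'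
+ₛ-cong ea eb n = cong₂ Q._+_ (ea n) (eb n)

*ₛ-cong : ∀ {a a' b b'} → a ≗ a' → b ≗ b' → a *ₛ b ≗ a' *ₛ b'
*ₛ-cong ea eb zero = cong₂ Q._*_ (ea 0) (eb 0)
*ₛ-cong ea eb (suc n) = cong₂ Q._+_ (cong₂ Q._*_ (ea 0) (eb (suc n))) (*ₛ-cong (λ k → ea (suc k)) eb n)

*ₛ-zeroˡ : ∀ {a} b → a ≗ 0ₛ → a *ₛ b ≗ 0ₛ
*ₛ-zeroˡ b a≗0 zero rewrite a≗0 0 = QP.*-zeroˡ (b 0)
*ₛ-zeroˡ b a≗0 (suc n) rewrite a≗0 0 | *ₛ-zeroˡ b (λ k → a≗0 (suc k)) n =
  trans (cong (Q._+ 0ℚ) (QP.*-zeroˡ (b (suc n)))) refl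

*ₛ-zeroʳ : ∀ a {b} → b ≗ 0ₛ → a *ₛ b ≗ 0ₛ
*ₛ-zeroʳ a b≗0 zero rewrite b≗0 0 = QP.*-zeroʳ (a 0)
*ₛ-zeroʳ a b≗0 (suc n) rewrite b≗0 (suc n) | *ₛ-zeroʳ (shift a) b≗0 n =
  trans (cong (Q._+ 0ℚ) (QP.*-zeroʳ (a 0))) refl

*ₛ-distribʳ : ∀ a b c → (a +ₛ b) *ₛ c ≗ a *ₛ c +ₛ b *ₛ c
*ₛ-distribʳ a b c zero = QP.*-distribʳ-+ (c 0) (a 0) (b 0)
*ₛ-distribʳ a b c (suc n) rewrite *ₛ-distribʳ (shift a) (shift b) c n =
  solve 5 (λ x y z u v → (x :+ y) :* z :+ (u :+ v) := (x :* z :+ u) :+ (y :* z :+ v)) refl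
    (a 0) (b 0) (c (suc n)) ((shift a *ₛ c) n) ((shift b *ₛ c) n)

*ₛ-distribˡ : ∀ a b c → a *ₛ (b +ₛ c) ≗ a *ₛ b +ₛ a *ₛ c
*ₛ-distribˡ a b c zero = QP.*-distribˡ-+ (a 0) (b 0) (c 0)
*ₛ-distribˡ a b c (suc n) rewrite *ₛ-distribˡ (shift a) b c n =
  solve 5 (λ x y z u v → x :* (y :+ z) :+ (u :+ v) := (x :* y :+ u) :+ (x :* z :+ v)) refl
    (a 0) (b (suc n)) (c (suc n)) ((shift a *ₛ b) n) ((shift a *ₛ c) n)

*ₛ-scalˡ : ∀ k a b → (k ·ₛ a) *ₛ b ≗ k ·ₛ (a *ₛ b)
*ₛ-scalˡ k a b zero = QP.*-assoc k (a 0) (b 0)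
*ₛ-scalˡ k a b (suc n) rewrite *ₛ-scalˡ k (shift a) b n =
  solve 4 (λ k x y u → k :* x :* y :+ k :* u := k :* (x :* y :+ u)) refl k (a 0) (b (suc n)) ((shift a *ₛ b) n)

*ₛ-scalʳ : ∀ k a b → a *ₛ (k ·ₛ b) ≗ k ·ₛ (a *ₛ b)
*ₛ-scalʳ k a b zero = solve 3 (λ k x y → x :* (k :* y) := k :* (x :* y)) refl k (a 0) (b 0)
*ₛ-scalʳ k a b (suc n) rewrite *ₛ-scalʳ k (shift a) b n =
  solve 4 (λ k x y u → x :* (k :* y) :+ k :* u := k :* (x :* y :+ u)) refl k (a 0) (b (suc n)) ((shift a *ₛ b) n)

*ₛ-unfoldʳ : ∀ a b n → (a *ₛ b) (suc n) ≡ (a *ₛ shift b) n Q.+ a (suc n) Q.* b 0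
*ₛ-unfoldʳ a b zero = refl
*ₛ-unfoldʳ a b (suc n) rewrite *ₛ-unfoldʳ (shift a) b n =
  solve 3 (λ x u v → x :+ (u :+ v) := (x :+ u) :+ v) refl
    (a 0 Q.* b (suc (suc n))) ((shift a *ₛ shift b) n) (a (suc (suc n)) Q.* b 0)

*ₛ-comm : ∀ a b → a *ₛ b ≗ b *ₛ a
*ₛ-comm a b zero = QP.*-comm (a 0) (b 0)
*ₛ-comm a b (suc n) rewrite *ₛ-comm (shift a) b n | *ₛ-unfoldʳ b a n =
  solve 3 (λ x y u → x :* y :+ u := u :+ y :* x) refl (a 0) (b (suc n)) ((b *ₛ shift a) n)

*ₛ-assoc : ∀ a b c → (a *ₛ b) *ₛ c ≗ a *ₛ (b *ₛ c)
*ₛ-assoc a b c zero = QP.*-assoc (a 0) (b 0) (c 0)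
*ₛ-assoc a b c (suc n) =
  trans (cong (a 0 Q.* b 0 Q.* c (suc n) Q.+_)
          (trans (*ₛ-distribʳ (a 0 ·ₛ shift b) (shift a *ₛ b) c n)
                 (cong₂ Q._+_ (*ₛ-scalˡ (a 0) (shift b) c n) (*ₛ-assoc (shift a) b c n))))
    (solve 5 (λ x y z u v → x :* y :* z :+ (x :* u :+ v) := x :* (y :* z :+ u) :+ v) refl
       (a 0) (b 0) (c (suc n)) ((shift b *ₛ c) n) ((shift a *ₛ (b *ₛ c)) n))

*ₛ-leftComm : ∀ a b c → a *ₛ (b *ₛ c) ≗ b *ₛ (a *ₛ c)
*ₛ-leftComm a b c = begin
    a *ₛ (b *ₛ c)   ≈⟨ *ₛ-assoc a b c ⟨
    (a *ₛ b) *ₛ c   ≈⟨ *ₛ-cong (*ₛ-comm a b) (λ _ → refl) ⟩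
    (b *ₛ a) *ₛ c   ≈⟨ *ₛ-assoc b a c ⟩
    b *ₛ (a *ₛ c)   ∎
  where open ≗-Reasoning

*ₛ-identityˡ : ∀ a → 1ₛ *ₛ a ≗ a
*ₛ-identityˡ a zero = QP.*-identityˡ (a 0)
*ₛ-identityˡ a (suc n) rewrite *ₛ-zeroˡ a (λ _ → refl) n =
  trans (QP.+-identityʳ _) (QP.*-identityˡ (a (suc n)))

monomial-* : ∀ k l → monomial k *ₛ monomial l ≗ monomial (k ℕ.+ l)
monomial-* zero l zero = QP.*-identityˡ (monomial l 0)
monomial-* zero l (suc n) =
  trans (cong₂ Q._+_ (QP.*-identityˡ (monomial l (suc n))) (*ₛ-zeroˡ (monomial l) (λ _ → refl) n))
        (QP.+-identityʳ _)
monomial-* (suc k) l zero = QP.*-zeroˡ (monomial l 0)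
monomial-* (suc k) l (suc n) =
  trans (cong₂ Q._+_ (QP.*-zeroˡ (monomial l (suc n))) (monomial-* k l n)) (QP.+-identityˡ _)

*ₛ-local : ∀ n {a b a' b'} → (∀ i → i ℕ.≤ n → a i ≡ a' i) → (∀ i → i ℕ.≤ n → b i ≡ b' i) →
  (a *ₛ b) n ≡ (a' *ₛ b') n
*ₛ-local zero ea eb = cong₂ Q._*_ (ea 0 z≤n) (eb 0 z≤n)
*ₛ-local (suc n) ea eb =
  cong₂ Q._+_ (cong₂ Q._*_ (ea 0 z≤n) (eb (suc n) ℕP.≤-refl))
    (*ₛ-local n (λ i i≤n → ea (suc i) (s≤s i≤n)) (λ i i≤n → eb i (ℕP.m≤n⇒m≤1+n i≤n)))

-- ... and if both factors have zero constant term, only i < n matters, since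
-- (a * b)₀ = (a * b)₁ = 0 and (a * b)_{k+2} = (shift a * shift b)ₖ.
*ₛ-vanish≤1 : ∀ a b n → a 0 ≡ 0ℚ → b 0 ≡ 0ℚ → n ℕ.≤ 1 → (a *ₛ b) n ≡ 0ℚ
*ₛ-vanish≤1 a b zero a₀ b₀ _ rewrite a₀ = QP.*-zeroˡ (b 0)
*ₛ-vanish≤1 a b (suc zero) a₀ b₀ _ rewrite a₀ | b₀ =
  trans (cong₂ Q._+_ (QP.*-zeroˡ (b 1)) (QP.*-zeroʳ (a 1))) refl
*ₛ-vanish≤1 a b (suc (suc n)) a₀ b₀ (s≤s ())

*ₛ-shift² : ∀ a b k → a 0 ≡ 0ℚ → b 0 ≡ 0ℚ → (a *ₛ b) (suc (suc k)) ≡ (shift a *ₛ shift b) k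
*ₛ-shift² a b k a₀ b₀ rewrite a₀ | *ₛ-unfoldʳ (shift a) b k | b₀ =
  trans (cong₂ Q._+_ (QP.*-zeroˡ (b (suc (suc k))))
                     (cong ((shift a *ₛ shift b) k Q.+_) (QP.*-zeroʳ (a (suc (suc k))))))
        (trans (QP.+-identityˡ _) (QP.+-identityʳ _))

*ₛ-local₀ : ∀ n {a b a' b'} → a 0 ≡ 0ℚ → b 0 ≡ 0ℚ → a' 0 ≡ 0ℚ → b' 0 ≡ 0ℚ →
  (∀ i → i ℕ.< n → a i ≡ a' i) → (∀ i → i ℕ.< n → b i ≡ b' i) → (a *ₛ b) n ≡ (a' *ₛ b') n
*ₛ-local₀ zero {a} {b} {a'} {b'} a₀ b₀ a'₀ b'₀ _ _ =
  trans (*ₛ-vanish≤1 a b 0 a₀ b₀ z≤n) (sym (*ₛ-vanish≤1 a' b' 0 a'₀ b'₀ z≤n))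
*ₛ-local₀ (suc zero) {a} {b} {a'} {b'} a₀ b₀ a'₀ b'₀ _ _ =
  trans (*ₛ-vanish≤1 a b 1 a₀ b₀ ℕP.≤-refl) (sym (*ₛ-vanish≤1 a' b' 1 a'₀ b'₀ ℕP.≤-refl))
*ₛ-local₀ (suc (suc k)) {a} {b} {a'} {b'} a₀ b₀ a'₀ b'₀ ea eb = begin
    (a *ₛ b) (suc (suc k))                ≡⟨ *ₛ-shift² a b k a₀ b₀ ⟩
    (shift a *ₛ shift b) k                ≡⟨ *ₛ-local k (λ i i≤k → ea (suc i) (s≤s (s≤s i≤k)))
                                                        (λ i i≤k → eb (suc i) (s≤s (s≤s i≤k))) ⟩
    (shift a' *ₛ shift b') k              ≡⟨ *ₛ-shift² a' b' k a'₀ b'₀ ⟨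
    (a' *ₛ b') (suc (suc k))              ∎
  where open ≡-Reasoning

IsPolynomial : Series → Set
IsPolynomial p = Σ ℕ λ d → ∀ n → d ℕ.≤ n → p n ≡ 0ℚ

polynomial-0 : IsPolynomial 0ₛ
polynomial-0 = 0 , λ _ _ → refl

polynomial-1 : IsPolynomial 1ₛ
polynomial-1 = 1 , λ { zero () ; (suc n) _ → refl }

polynomial-monomial : ∀ k → IsPolynomial (monomial k)
polynomial-monomial k = suc k , vanish k
  where
  vanish : ∀ k n → k ℕ.< n → monomial k n ≡ 0ℚ
  vanish zero (suc n) _ = refl
  vanish (suc k) (suc n) (s≤s k<n) = vanish k n k<n

polynomial-+ : ∀ {p q} → IsPolynomial p → IsPolynomial q → IsPolynomial (p +ₛ q)
polynomial-+ (d₁ , z₁) (d₂ , z₂) = d₁ ℕ.+ d₂ , λ n le →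
  trans (cong₂ Q._+_ (z₁ n (ℕP.≤-trans (ℕP.m≤m+n d₁ d₂) le)) (z₂ n (ℕP.≤-trans (ℕP.m≤n+m d₂ d₁) le))) refl

polynomial-· : ∀ k {p} → IsPolynomial p → IsPolynomial (k ·ₛ p)
polynomial-· k (d , z) = d , λ n le → trans (cong (k Q.*_) (z n le)) (QP.*-zeroʳ k)

polynomial-* : ∀ {p q} → IsPolynomial p → IsPolynomial q → IsPolynomial (p *ₛ q)
polynomial-* {p} {q} (d₁ , z₁) (d₂ , z₂) = d₁ ℕ.+ d₂ , vanish d₁ p z₁
  where
  vanish : ∀ d₁ p → (∀ n → d₁ ℕ.≤ n → p n ≡ 0ℚ) → ∀ n → d₁ ℕ.+ d₂ ℕ.≤ n → (p *ₛ q) n ≡ 0ℚ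
  vanish zero p z₁ n _ = *ₛ-zeroˡ q (λ k → z₁ k z≤n) n
  vanish (suc d₁) p z₁ (suc n) (s≤s le)
    rewrite z₂ (suc n) (ℕP.≤-trans (ℕP.m≤n+m d₂ d₁) (ℕP.≤-trans le (ℕP.n≤1+n n)))
          | vanish d₁ (shift p) (λ k l → z₁ (suc k) (s≤s l)) n le
    = trans (cong (Q._+ 0ℚ) (QP.*-zeroʳ (p 0))) refl

record Rational (a : Series) : Set where
  constructor rational
  field
    num den   : Series
    num-poly  : IsPolynomial num
    den-poly  : IsPolynomial den
    den₀≢0    : den 0 ≢ 0ℚ
    den*a≗num : den *ₛ a ≗ num

rational-cong : ∀ {a b} → a ≗ b → Rational a → Rational b
rational-cong a≗b (rational P Q pP pQ Q₀≢0 e) =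
  rational P Q pP pQ Q₀≢0 (λ n → trans (*ₛ-cong (λ _ → refl) (λ k → sym (a≗b k)) n) (e n))

rational-poly : ∀ {p} → IsPolynomial p → Rational p
rational-poly {p} pp = rational p 1ₛ pp polynomial-1 QP.1≢0 (*ₛ-identityˡ p)

rational-0 : Rational 0ₛ
rational-0 = rational-poly polynomial-0

rational-+ : ∀ {a b} → Rational a → Rational b → Rational (a +ₛ b)
rational-+ {a} {b} (rational P₁ Q₁ pP₁ pQ₁ nz₁ e₁) (rational P₂ Q₂ pP₂ pQ₂ nz₂ e₂) =
  rational (Q₂ *ₛ P₁ +ₛ Q₁ *ₛ P₂) (Q₁ *ₛ Q₂)
    (polynomial-+ (polynomial-* pQ₂ pP₁) (polynomial-* pQ₁ pP₂)) (polynomial-* pQ₁ pQ₂) (*-≢0 nz₁ nz₂)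
    (begin
      (Q₁ *ₛ Q₂) *ₛ (a +ₛ b)                    ≈⟨ *ₛ-distribˡ (Q₁ *ₛ Q₂) a b ⟩
      (Q₁ *ₛ Q₂) *ₛ a +ₛ (Q₁ *ₛ Q₂) *ₛ b        ≈⟨ +ₛ-cong (*ₛ-assoc Q₁ Q₂ a) (*ₛ-assoc Q₁ Q₂ b) ⟩
      Q₁ *ₛ (Q₂ *ₛ a) +ₛ Q₁ *ₛ (Q₂ *ₛ b)        ≈⟨ +ₛ-cong (*ₛ-leftComm Q₁ Q₂ a) (*ₛ-cong (λ _ → refl) e₂) ⟩
      Q₂ *ₛ (Q₁ *ₛ a) +ₛ Q₁ *ₛ P₂               ≈⟨ +ₛ-cong (*ₛ-cong (λ _ → refl) e₁) (λ _ → refl) ⟩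
      Q₂ *ₛ P₁ +ₛ Q₁ *ₛ P₂                      ∎)
  where open ≗-Reasoning

rational-* : ∀ {a b} → Rational a → Rational b → Rational (a *ₛ b)
rational-* {a} {b} (rational P₁ Q₁ pP₁ pQ₁ nz₁ e₁) (rational P₂ Q₂ pP₂ pQ₂ nz₂ e₂) =
  rational (P₁ *ₛ P₂) (Q₁ *ₛ Q₂) (polynomial-* pP₁ pP₂) (polynomial-* pQ₁ pQ₂) (*-≢0 nz₁ nz₂)
    (begin
      (Q₁ *ₛ Q₂) *ₛ (a *ₛ b)   ≈⟨ *ₛ-assoc Q₁ Q₂ (a *ₛ b) ⟩
      Q₁ *ₛ (Q₂ *ₛ (a *ₛ b))   ≈⟨ *ₛ-cong (λ _ → refl) (*ₛ-leftComm Q₂ a b) ⟩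
      Q₁ *ₛ (a *ₛ (Q₂ *ₛ b))   ≈⟨ *ₛ-assoc Q₁ a (Q₂ *ₛ b) ⟨
      (Q₁ *ₛ a) *ₛ (Q₂ *ₛ b)   ≈⟨ *ₛ-cong e₁ e₂ ⟩
      P₁ *ₛ P₂                 ∎)
  where open ≗-Reasoning

rational-ι : ∀ b {a} → (b ≡ true → Rational a) → Rational (ι b ·ₛ a)
rational-ι true {a} rat = rational-cong (λ n → sym (QP.*-identityˡ (a n))) (rat refl)
rational-ι false {a} _ = rational-cong (λ n → sym (QP.*-zeroˡ (a n))) rational-0

rational-𝟙 : ∀ {P : Set} (d : Dec P) {a} → (P → Rational a) → Rational (𝟙 d ·ₛ a)
rational-𝟙 (yes p) {a} rat = rational-ι true {a} (λ _ → rat p)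
rational-𝟙 (no _) {a} _ = rational-ι false {a} (λ ())

-- With G = P/Q and L = P'/Q' one gets (Q − P)·F = Q·L,
-- so F = Q·P' / (Q'·(Q − P)), and (Q − P)(0) = Q(0) ≠ 0 because P(0) = 0.
rational-fix : ∀ {F L G} → Rational L → Rational G → G 0 ≡ 0ℚ → F ≗ L +ₛ F *ₛ G → Rational F
rational-fix {F} {L} {G} (rational P' Q' pP' pQ' nz' e') (rational P Q pP pQ nz e) G₀≡0 F≗L+FG =
  rational (Q *ₛ P') (Q' *ₛ D) (polynomial-* pQ pP') (polynomial-* pQ' (polynomial-+ pQ (polynomial-· (Q.- 1ℚ) pP)))
    (*-≢0 nz' D₀≢0) Q'D*F≗QP'
  where
  D : Series
  D = Q +ₛ (Q.- 1ℚ) ·ₛ P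

  P₀≡0 : P 0 ≡ 0ℚ
  P₀≡0 = trans (sym (e 0)) (trans (cong (Q 0 Q.*_) G₀≡0) (QP.*-zeroʳ (Q 0)))

  D₀≢0 : D 0 ≢ 0ℚ
  D₀≢0 D₀≡0 = nz (begin
      Q 0                      ≡⟨ solve 1 (λ x → x := x :+ (:- con 1ℚ) :* con 0ℚ) refl (Q 0) ⟩
      Q 0 Q.+ (Q.- 1ℚ) Q.* 0ℚ  ≡⟨ cong (λ z → Q 0 Q.+ (Q.- 1ℚ) Q.* z) P₀≡0 ⟨
      D 0                      ≡⟨ D₀≡0 ⟩
      0ℚ                       ∎)
    where open ≡-Reasoning

  Q*F : Q *ₛ F ≗ Q *ₛ L +ₛ Q *ₛ (F *ₛ G)
  Q*F = begin
      Q *ₛ F                       ≈⟨ *ₛ-cong (λ _ → refl) F≗L+FG ⟩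
      Q *ₛ (L +ₛ F *ₛ G)           ≈⟨ *ₛ-distribˡ Q L (F *ₛ G) ⟩
      Q *ₛ L +ₛ Q *ₛ (F *ₛ G)      ∎
    where open ≗-Reasoning

  P*F : P *ₛ F ≗ Q *ₛ (F *ₛ G)
  P*F = begin
      P *ₛ F            ≈⟨ *ₛ-cong e (λ _ → refl) ⟨
      (Q *ₛ G) *ₛ F     ≈⟨ *ₛ-assoc Q G F ⟩
      Q *ₛ (G *ₛ F)     ≈⟨ *ₛ-cong (λ _ → refl) (*ₛ-comm G F) ⟩
      Q *ₛ (F *ₛ G)     ∎
    where open ≗-Reasoning

  D*F : D *ₛ F ≗ Q *ₛ L
  D*F n = begin
      (D *ₛ F) n
        ≡⟨ *ₛ-distribʳ Q ((Q.- 1ℚ) ·ₛ P) F n ⟩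
      (Q *ₛ F) n Q.+ (((Q.- 1ℚ) ·ₛ P) *ₛ F) n
        ≡⟨ cong₂ Q._+_ (Q*F n) (trans (*ₛ-scalˡ (Q.- 1ℚ) P F n) (cong ((Q.- 1ℚ) Q.*_) (P*F n))) ⟩
      ((Q *ₛ L) n Q.+ (Q *ₛ (F *ₛ G)) n) Q.+ (Q.- 1ℚ) Q.* (Q *ₛ (F *ₛ G)) n
        ≡⟨ solve 2 (λ x y → (x :+ y) :+ (:- con 1ℚ) :* y := x) refl ((Q *ₛ L) n) ((Q *ₛ (F *ₛ G)) n) ⟩
      (Q *ₛ L) n ∎
    where open ≡-Reasoning

  Q'D*F≗QP' : (Q' *ₛ D) *ₛ F ≗ Q *ₛ P'
  Q'D*F≗QP' = begin
      (Q' *ₛ D) *ₛ F     ≈⟨ *ₛ-assoc Q' D F ⟩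
      Q' *ₛ (D *ₛ F)     ≈⟨ *ₛ-cong (λ _ → refl) D*F ⟩
      Q' *ₛ (Q *ₛ L)     ≈⟨ *ₛ-leftComm Q' Q L ⟩
      Q *ₛ (Q' *ₛ L)     ≈⟨ *ₛ-cong (λ _ → refl) e' ⟩
      Q *ₛ P'            ∎
    where open ≗-Reasoning

coefficients : Series → ℕ → List ℚ
coefficients p zero = []
coefficients p (suc d) = p 0 ∷ coefficients (shift p) d

coeff-coefficients : ∀ d p → (∀ n → d ℕ.≤ n → p n ≡ 0ℚ) → coeff (coefficients p d) ≗ p
coeff-coefficients zero p z n = sym (z n z≤n)
coeff-coefficients (suc d) p z zero = refl
coeff-coefficients (suc d) p z (suc n) = coeff-coefficients d (shift p) (λ k l → z (suc k) (s≤s l)) n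

mulCoeff-*ₛ : ∀ qs a → mulCoeff qs a ≗ coeff qs *ₛ (λ m → toℚ (a m))
mulCoeff-*ₛ [] a n = sym (*ₛ-zeroˡ _ (λ _ → refl) n)
mulCoeff-*ₛ (q ∷ qs) a zero = refl
mulCoeff-*ₛ (q ∷ qs) a (suc n) = cong (q Q.* toℚ (a (suc n)) Q.+_) (mulCoeff-*ₛ qs a n)

toIsRationalGF : ∀ a → Rational (λ n → toℚ (a n)) → IsRationalGF a
toIsRationalGF a (rational P Q (dP , zP) (zero , zQ) Q₀≢0 e) = ⊥-elim (Q₀≢0 (zQ 0 z≤n))
toIsRationalGF a (rational P Q (dP , zP) (suc dQ , zQ) Q₀≢0 e) =
  coefficients P dP , coefficients Q (suc dQ) , here Q₀≢0 , λ n →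
    trans (mulCoeff-*ₛ (coefficients Q (suc dQ)) a n)
    (trans (*ₛ-cong (coeff-coefficients (suc dQ) Q zQ) (λ _ → refl) n)
    (trans (e n) (sym (coeff-coefficients dP P zP n))))

∑ : List A → (A → ℚ) → ℚ
∑ [] g = 0ℚ
∑ (x ∷ xs) g = g x Q.+ ∑ xs g

syntax ∑ xs (λ x → g) = ∑[ x ∈ xs ] g

∑ₛ : List A → (A → Series) → Series
∑ₛ xs g n = ∑[ x ∈ xs ] g x n

∑-cong : ∀ (xs : List A) {g h} → (∀ x → g x ≡ h x) → ∑ xs g ≡ ∑ xs h
∑-cong [] e = refl
∑-cong (x ∷ xs) e = cong₂ Q._+_ (e x) (∑-cong xs e)

∑-+ : ∀ (xs : List A) (g h : A → ℚ) → ∑[ x ∈ xs ] (g x Q.+ h x) ≡ ∑ xs g Q.+ ∑ xs h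
∑-+ [] g h = refl
∑-+ (x ∷ xs) g h rewrite ∑-+ xs g h =
  solve 4 (λ a b c d → (a :+ b) :+ (c :+ d) := (a :+ c) :+ (b :+ d)) refl (g x) (h x) (∑ xs g) (∑ xs h)

∑-scal : ∀ (xs : List A) c (g : A → ℚ) → ∑[ x ∈ xs ] (c Q.* g x) ≡ c Q.* ∑ xs g
∑-scal [] c g = sym (QP.*-zeroʳ c)
∑-scal (x ∷ xs) c g rewrite ∑-scal xs c g = sym (QP.*-distribˡ-+ c (g x) (∑ xs g))

∑-zero : ∀ (xs : List A) {g} → (∀ x → g x ≡ 0ℚ) → ∑ xs g ≡ 0ℚ
∑-zero [] e = refl
∑-zero (x ∷ xs) e rewrite e x | ∑-zero xs e = refl

∑-++ : ∀ (xs ys : List A) (g : A → ℚ) → ∑ (xs ++ ys) g ≡ ∑ xs g Q.+ ∑ ys g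
∑-++ [] ys g = sym (QP.+-identityˡ _)
∑-++ (x ∷ xs) ys g rewrite ∑-++ xs ys g = sym (QP.+-assoc (g x) (∑ xs g) (∑ ys g))

∑-concatMap : ∀ (h : A → List B) xs (g : B → ℚ) → ∑ (concatMap h xs) g ≡ ∑[ x ∈ xs ] ∑ (h x) g
∑-concatMap h [] g = refl
∑-concatMap h (x ∷ xs) g = trans (∑-++ (h x) (concatMap h xs) g) (cong (∑ (h x) g Q.+_) (∑-concatMap h xs g))

∑-map : ∀ (h : A → B) xs (g : B → ℚ) → ∑ (map h xs) g ≡ ∑[ x ∈ xs ] g (h x)
∑-map h [] g = refl
∑-map h (x ∷ xs) g = cong (g (h x) Q.+_) (∑-map h xs g)

∑-comm : ∀ (xs : List A) (ys : List B) (g : A → B → ℚ) → ∑[ x ∈ xs ] ∑[ y ∈ ys ] g x y ≡ ∑[ y ∈ ys ] ∑[ x ∈ xs ] g x y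
∑-comm [] ys g = sym (∑-zero ys (λ _ → refl))
∑-comm (x ∷ xs) ys g = trans (cong (∑ ys (g x) Q.+_) (∑-comm xs ys g)) (sym (∑-+ ys (g x) (λ y → ∑[ x' ∈ xs ] g x' y)))

∑-filter : ∀ {P : A → Set} (P? : Decidable P) xs (g : A → ℚ) → ∑ (filter P? xs) g ≡ ∑[ x ∈ xs ] (𝟙 (P? x) Q.* g x)
∑-filter P? [] g = refl
∑-filter P? (x ∷ xs) g with does (P? x)
... | false = trans (∑-filter P? xs g) (sym (trans (cong (Q._+ ∑[ y ∈ xs ] (𝟙 (P? y) Q.* g y)) (QP.*-zeroˡ (g x))) (QP.+-identityˡ _)))
... | true = cong₂ Q._+_ (sym (QP.*-identityˡ (g x))) (∑-filter P? xs g)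

length-filter : ∀ {P : A → Set} (P? : Decidable P) xs → toℚ (length (filter P? xs)) ≡ ∑[ x ∈ xs ] 𝟙 (P? x)
length-filter P? [] = refl
length-filter P? (x ∷ xs) with does (P? x)
... | false = trans (length-filter P? xs) (sym (QP.+-identityˡ _))
... | true = trans (toℚ-+ 1 (length (filter P? xs))) (cong (1ℚ Q.+_) (length-filter P? xs))

*ₛ-∑ˡ : ∀ (xs : List A) g b → ∑ₛ xs g *ₛ b ≗ ∑ₛ xs (λ x → g x *ₛ b)
*ₛ-∑ˡ [] g b n = *ₛ-zeroˡ b (λ _ → refl) n
*ₛ-∑ˡ (x ∷ xs) g b n = trans (*ₛ-distribʳ (g x) (∑ₛ xs g) b n) (cong ((g x *ₛ b) n Q.+_) (*ₛ-∑ˡ xs g b n))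

*ₛ-∑ʳ : ∀ (xs : List A) a g → a *ₛ ∑ₛ xs g ≗ ∑ₛ xs (λ x → a *ₛ g x)
*ₛ-∑ʳ [] a g n = *ₛ-zeroʳ a (λ _ → refl) n
*ₛ-∑ʳ (x ∷ xs) a g n = trans (*ₛ-distribˡ a (g x) (∑ₛ xs g) n) (cong ((a *ₛ g x) n Q.+_) (*ₛ-∑ʳ xs a g n))

∑-products : ∀ (xs : List A) (ys : List B) c (u : A → Series) (v : B → Series) n →
  ∑[ x ∈ xs ] ∑[ y ∈ ys ] (c Q.* (u x *ₛ v y) n) ≡ c Q.* (∑ₛ xs u *ₛ ∑ₛ ys v) n
∑-products xs ys c u v n = begin
    ∑[ x ∈ xs ] ∑[ y ∈ ys ] (c Q.* (u x *ₛ v y) n)   ≡⟨ ∑-cong xs (λ x → ∑-scal ys c (λ y → (u x *ₛ v y) n)) ⟩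
    ∑[ x ∈ xs ] (c Q.* ∑[ y ∈ ys ] (u x *ₛ v y) n)   ≡⟨ ∑-scal xs c (λ x → ∑[ y ∈ ys ] (u x *ₛ v y) n) ⟩
    c Q.* ∑[ x ∈ xs ] ∑[ y ∈ ys ] (u x *ₛ v y) n     ≡⟨ cong (c Q.*_) (∑-cong xs (λ x → *ₛ-∑ʳ ys (u x) v n)) ⟨
    c Q.* ∑[ x ∈ xs ] (u x *ₛ ∑ₛ ys v) n             ≡⟨ cong (c Q.*_) (*ₛ-∑ˡ xs u (∑ₛ ys v) n) ⟨
    c Q.* (∑ₛ xs u *ₛ ∑ₛ ys v) n                     ∎
  where open ≡-Reasoning

rational-∑ : ∀ (xs : List A) g → (∀ x → Rational (g x)) → Rational (∑ₛ xs g)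
rational-∑ [] g rat = rational-0
rational-∑ (x ∷ xs) g rat = rational-+ (rat x) (rational-∑ xs g rat)

Ty : Tree → Set
Ty leaf = ⊤
Ty (node a b) = Bool × Ty a × Ty b

_≟ᵗ_ : ∀ {t} (σ τ : Ty t) → Dec (σ ≡ τ)
_≟ᵗ_ {leaf} tt tt = yes refl
_≟ᵗ_ {node a b} (x , u , v) (y , u' , v') =
  map′ (λ { (refl , refl , refl) → refl }) (λ { refl → refl , refl , refl })
       (x ≟ᵇ y ×-dec u ≟ᵗ u' ×-dec v ≟ᵗ v')

bools : List Bool
bools = true ∷ false ∷ []

allTypes : (t : Tree) → List (Ty t)
allTypes leaf = tt ∷ []
allTypes (node a b) =
  concatMap (λ x → concatMap (λ u → map (λ v → x , u , v) (allTypes b)) (allTypes a)) bools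

∑-allTypes-node : ∀ a b (g : Ty (node a b) → ℚ) →
  ∑ (allTypes (node a b)) g ≡ ∑[ x ∈ bools ] ∑[ u ∈ allTypes a ] ∑[ v ∈ allTypes b ] g (x , u , v)
∑-allTypes-node a b g =
  trans (∑-concatMap (λ x → concatMap (λ u → map (λ v → x , u , v) (allTypes b)) (allTypes a)) bools g)
    (∑-cong bools (λ x → trans (∑-concatMap (λ u → map (λ v → x , u , v) (allTypes b)) (allTypes a) g)
                                 (∑-cong (allTypes a) (λ u → ∑-map (λ v → x , u , v) (allTypes b) g))))

∑-pick : ∀ t (σ : Ty t) (g : Ty t → ℚ) → ∑[ τ ∈ allTypes t ] (𝟙 (σ ≟ᵗ τ) Q.* g τ) ≡ g σ
∑-pick leaf tt g = trans (QP.+-identityʳ _) (QP.*-identityˡ (g tt))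
∑-pick (node a b) (x₀ , u₀ , v₀) g =
  trans (∑-allTypes-node a b (λ τ → 𝟙 ((x₀ , u₀ , v₀) ≟ᵗ τ) Q.* g τ))
        (trans (∑-cong bools pick-children) (pick-root x₀))
  where
  open ≡-Reasoning
  as = allTypes a
  bs = allTypes b
  pick-children : ∀ x →
    ∑[ u ∈ as ] ∑[ v ∈ bs ] (𝟙 ((x₀ , u₀ , v₀) ≟ᵗ (x , u , v)) Q.* g (x , u , v)) ≡ 𝟙 (x₀ ≟ᵇ x) Q.* g (x , u₀ , v₀)
  pick-children x = begin
      ∑[ u ∈ as ] ∑[ v ∈ bs ] (𝟙 ((x₀ , u₀ , v₀) ≟ᵗ (x , u , v)) Q.* g (x , u , v))
        ≡⟨ ∑-cong as (λ u → ∑-cong bs (factor u)) ⟩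
      ∑[ u ∈ as ] ∑[ v ∈ bs ] (𝟙 (x₀ ≟ᵇ x) Q.* h u v)
        ≡⟨ trans (∑-cong as (λ u → ∑-scal bs (𝟙 (x₀ ≟ᵇ x)) (h u))) (∑-scal as (𝟙 (x₀ ≟ᵇ x)) (λ u → ∑ bs (h u))) ⟩
      𝟙 (x₀ ≟ᵇ x) Q.* ∑[ u ∈ as ] ∑ bs (h u)
        ≡⟨ cong (𝟙 (x₀ ≟ᵇ x) Q.*_) (∑-cong as pick-right) ⟩
      𝟙 (x₀ ≟ᵇ x) Q.* ∑[ u ∈ as ] (𝟙 (u₀ ≟ᵗ u) Q.* g (x , u , v₀))
        ≡⟨ cong (𝟙 (x₀ ≟ᵇ x) Q.*_) (∑-pick a u₀ (λ u → g (x , u , v₀))) ⟩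
      𝟙 (x₀ ≟ᵇ x) Q.* g (x , u₀ , v₀) ∎
    where
    h : Ty a → Ty b → ℚ
    h u v = 𝟙 (u₀ ≟ᵗ u) Q.* (𝟙 (v₀ ≟ᵗ v) Q.* g (x , u , v))
    factor : ∀ u v → 𝟙 ((x₀ , u₀ , v₀) ≟ᵗ (x , u , v)) Q.* g (x , u , v) ≡ 𝟙 (x₀ ≟ᵇ x) Q.* h u v
    factor u v = trans (ι-∧ (does (x₀ ≟ᵇ x)) (does (u₀ ≟ᵗ u) ∧ does (v₀ ≟ᵗ v)) (g (x , u , v)))
      (cong (𝟙 (x₀ ≟ᵇ x) Q.*_) (ι-∧ (does (u₀ ≟ᵗ u)) (does (v₀ ≟ᵗ v)) (g (x , u , v))))
    pick-right : ∀ u → ∑ bs (h u) ≡ 𝟙 (u₀ ≟ᵗ u) Q.* g (x , u , v₀)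
    pick-right u = trans (∑-scal bs (𝟙 (u₀ ≟ᵗ u)) (λ v → 𝟙 (v₀ ≟ᵗ v) Q.* g (x , u , v)))
                         (cong (𝟙 (u₀ ≟ᵗ u) Q.*_) (∑-pick b v₀ (λ v → g (x , u , v))))
  pick-root : ∀ x₀ → ∑[ x ∈ bools ] (𝟙 (x₀ ≟ᵇ x) Q.* g (x , u₀ , v₀)) ≡ g (x₀ , u₀ , v₀)
  pick-root true = begin
      1ℚ Q.* g (true , u₀ , v₀) Q.+ (0ℚ Q.* g (false , u₀ , v₀) Q.+ 0ℚ)
        ≡⟨ solve 2 (λ p q → con 1ℚ :* p :+ (con 0ℚ :* q :+ con 0ℚ) := p) refl (g (true , u₀ , v₀)) (g (false , u₀ , v₀)) ⟩
      g (true , u₀ , v₀) ∎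
  pick-root false = begin
      0ℚ Q.* g (true , u₀ , v₀) Q.+ (1ℚ Q.* g (false , u₀ , v₀) Q.+ 0ℚ)
        ≡⟨ solve 2 (λ p q → con 0ℚ :* p :+ (con 1ℚ :* q :+ con 0ℚ) := q) refl (g (true , u₀ , v₀)) (g (false , u₀ , v₀)) ⟩
      g (false , u₀ , v₀) ∎

contains : Tree → Tree → Bool
contains T t = does (contains? T t)

typeOf : (t : Tree) → Tree → Ty t
typeOf leaf T = tt
typeOf (node a b) T = contains T (node a b) , typeOf a T , typeOf b T

-- The bit of the root of t (every tree contains the one-vertex pattern).
rootBit : ∀ {t} → Ty t → Bool
rootBit {leaf} _ = true
rootBit {node a b} (x , _ , _) = x

rootBit-typeOf : ∀ t T → rootBit (typeOf t T) ≡ contains T t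
rootBit-typeOf leaf T = sym (dec-true (contains? T leaf) (T , here , tt))
rootBit-typeOf (node a b) T = refl

contains-node⇔ : ∀ l r a b → Contains (node l r) (node a b) ⇔
  (Contains l (node a b) ⊎ Contains r (node a b) ⊎ (Contains l a × Contains r b))
contains-node⇔ l r a b = mk⇔ to from
  where
  to : Contains (node l r) (node a b) → _
  to (s , here , e) = inj₂ (inj₂ e)
  to (s , inl p , e) = inj₁ (s , p , e)
  to (s , inr p , e) = inj₂ (inj₁ (s , p , e))
  from : _ → Contains (node l r) (node a b)
  from (inj₁ (s , p , e)) = s , inl p , e
  from (inj₂ (inj₁ (s , p , e))) = s , inr p , e
  from (inj₂ (inj₂ e)) = node l r , here , e

contains-node : ∀ l r a b →
  contains (node l r) (node a b) ≡ contains l (node a b) ∨ contains r (node a b) ∨ (contains l a ∧ contains r b)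
contains-node l r a b = does-⇔ (contains-node⇔ l r a b) (contains? (node l r) (node a b))
  (contains? l (node a b) ⊎-dec contains? r (node a b) ⊎-dec (contains? l a ×-dec contains? r b))

-- The type of node l r computed from the types of l and r: the pattern at a
-- vertex is contained iff it is contained in l, in r, or its two children
-- patterns are contained in l and r respectively.
combine : ∀ {t} → Ty t → Ty t → Ty t
combine {leaf} _ _ = tt
combine {node a b} (x , u , v) (y , u' , v') = (x ∨ y ∨ (rootBit u ∧ rootBit v')) , combine u u' , combine v v'

typeOf-node : ∀ t l r → typeOf t (node l r) ≡ combine (typeOf t l) (typeOf t r)
typeOf-node leaf l r = refl
typeOf-node (node a b) l r
  rewrite rootBit-typeOf a l | rootBit-typeOf b r | typeOf-node a l r | typeOf-node b l r
  = cong (λ x → x , combine (typeOf a l) (typeOf a r) , combine (typeOf b l) (typeOf b r)) (contains-node l r a b)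

_≤ᵗ_ : ∀ {t} → Ty t → Ty t → Set
_≤ᵗ_ {leaf} _ _ = ⊤
_≤ᵗ_ {node a b} (x , u , v) (y , u' , v') = (x ≡ true → y ≡ true) × u ≤ᵗ u' × v ≤ᵗ v'

bit : Bool → ℕ
bit true = 1
bit false = 0

weight : ∀ {t} → Ty t → ℕ
weight {leaf} _ = 0
weight {node a b} (x , u , v) = bit x ℕ.+ (weight u ℕ.+ weight v)

combine-≥ˡ : ∀ {t} (σ ρ : Ty t) → σ ≤ᵗ combine σ ρ
combine-≥ˡ {leaf} σ ρ = tt
combine-≥ˡ {node a b} (x , u , v) (y , u' , v') = (λ { refl → refl }) , combine-≥ˡ u u' , combine-≥ˡ v v'

combine-≥ʳ : ∀ {t} (σ ρ : Ty t) → ρ ≤ᵗ combine σ ρ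
combine-≥ʳ {leaf} σ ρ = tt
combine-≥ʳ {node a b} (x , u , v) (y , u' , v') = y≤ x , combine-≥ʳ u u' , combine-≥ʳ v v'
  where
  y≤ : ∀ x {y} {z} → y ≡ true → x ∨ (y ∨ z) ≡ true
  y≤ true _ = refl
  y≤ false refl = refl

combine-below : ∀ {t} {σ ρ τ : Ty t} → combine σ ρ ≡ τ → σ ≤ᵗ τ × ρ ≤ᵗ τ
combine-below {σ = σ} {ρ} refl = combine-≥ˡ σ ρ , combine-≥ʳ σ ρ

≤ᵗ-rootBit : ∀ {t} {σ τ : Ty t} → σ ≤ᵗ τ → rootBit τ ≡ false → rootBit σ ≡ false
≤ᵗ-rootBit {leaf} _ ()
≤ᵗ-rootBit {node a b} {true , _ , _} (x≤y , _) y≡false with trans (sym (x≤y refl)) y≡false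
... | ()
≤ᵗ-rootBit {node a b} {false , _ , _} _ _ = refl

weight-≤ : ∀ {t} {σ τ : Ty t} → σ ≤ᵗ τ → weight σ ℕ.≤ weight τ
weight-≤ {leaf} _ = z≤n
weight-≤ {node a b} {x , u , v} {y , u' , v'} (x≤y , u≤u' , v≤v') =
  ℕP.+-mono-≤ (bit-≤ x y x≤y) (ℕP.+-mono-≤ (weight-≤ u≤u') (weight-≤ v≤v'))
  where
  bit-≤ : ∀ x y → (x ≡ true → y ≡ true) → bit x ℕ.≤ bit y
  bit-≤ false y _ = z≤n
  bit-≤ true y x≤y rewrite x≤y refl = ℕP.≤-refl

weight-< : ∀ {t} {σ τ : Ty t} → σ ≤ᵗ τ → σ ≢ τ → weight σ ℕ.< weight τ
weight-< {leaf} {tt} {tt} _ σ≢τ = ⊥-elim (σ≢τ refl)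
weight-< {node a b} {x , u , v} {y , u' , v'} (x≤y , u≤u' , v≤v') σ≢τ = root x y x≤y σ≢τ
  where
  children : ∀ z → (z , u , v) ≢ (z , u' , v') → weight u ℕ.+ weight v ℕ.< weight u' ℕ.+ weight v'
  children z ne with u ≟ᵗ u'
  ... | yes refl = ℕP.+-mono-≤-< ℕP.≤-refl (weight-< v≤v' (λ { refl → ne refl }))
  ... | no u≢u' = ℕP.+-mono-<-≤ (weight-< u≤u' u≢u') (weight-≤ v≤v')
  root : ∀ x y → (x ≡ true → y ≡ true) → (x , u , v) ≢ (y , u' , v') →
         weight {node a b} (x , u , v) ℕ.< weight {node a b} (y , u' , v')
  root true true _ ne = s≤s (children true ne)
  root false false _ ne = children false ne
  root true false x≤y _ with x≤y refl
  ... | ()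
  root false true _ _ = s≤s (ℕP.+-mono-≤ (weight-≤ u≤u') (weight-≤ v≤v'))

-- A type with root bit false is not stable under combining with itself: going
-- down from the root along unset bits, one meets an unset vertex whose two
-- children are set (leaves count as set), and combine switches it on.
combine-self : ∀ {t} (τ : Ty t) → rootBit τ ≡ false → combine τ τ ≢ τ
combine-self {leaf} τ ()
combine-self {node a b} (false , u , v) _ eq with rootBit u in ru
... | false = combine-self u ru (cong (λ z → proj₁ (proj₂ z)) eq)
... | true = combine-self v (cong proj₁ eq) (cong (λ z → proj₂ (proj₂ z)) eq)

module Counting (t : Tree) where

  types : List (Ty t)
  types = allTypes t

  treeGF : Tree → Ty t → Series
  treeGF T σ = 𝟙 (typeOf t T ≟ᵗ σ) ·ₛ monomial (leaves T)

  heightGF : ℕ → Ty t → Series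
  heightGF d σ = ∑ₛ (treesOfHeight≤ d) (λ T → treeGF T σ)

  -- all trees of type σ (trees with n leaves have height < n)
  typeGF : Ty t → Series
  typeGF σ n = heightGF n σ n

  Φ : (Ty t → Series) → Ty t → Series
  Φ F τ = treeGF leaf τ +ₛ ∑ₛ types (λ σ → ∑ₛ types (λ ρ → 𝟙 (combine σ ρ ≟ᵗ τ) ·ₛ (F σ *ₛ F ρ)))

  treeGF-node : ∀ a b τ n →
    treeGF (node a b) τ n ≡ ∑[ σ ∈ types ] ∑[ ρ ∈ types ] (𝟙 (combine σ ρ ≟ᵗ τ) Q.* (treeGF a σ *ₛ treeGF b ρ) n)
  treeGF-node a b τ n = sym (begin
      ∑[ σ ∈ types ] ∑[ ρ ∈ types ] (K σ ρ Q.* (treeGF a σ *ₛ treeGF b ρ) n)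
        ≡⟨ ∑-cong types (λ σ → ∑-cong types (λ ρ → regroup σ ρ)) ⟩
      ∑[ σ ∈ types ] ∑[ ρ ∈ types ] (𝟙 (typeOf t a ≟ᵗ σ) Q.* (𝟙 (typeOf t b ≟ᵗ ρ) Q.* (K σ ρ Q.* x^ab)))
        ≡⟨ ∑-cong types (λ σ → ∑-scal types (𝟙 (typeOf t a ≟ᵗ σ)) (λ ρ → 𝟙 (typeOf t b ≟ᵗ ρ) Q.* (K σ ρ Q.* x^ab))) ⟩
      ∑[ σ ∈ types ] (𝟙 (typeOf t a ≟ᵗ σ) Q.* ∑[ ρ ∈ types ] (𝟙 (typeOf t b ≟ᵗ ρ) Q.* (K σ ρ Q.* x^ab)))
        ≡⟨ ∑-pick t (typeOf t a) _ ⟩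
      ∑[ ρ ∈ types ] (𝟙 (typeOf t b ≟ᵗ ρ) Q.* (K (typeOf t a) ρ Q.* x^ab))
        ≡⟨ ∑-pick t (typeOf t b) _ ⟩
      K (typeOf t a) (typeOf t b) Q.* x^ab
        ≡⟨ cong₂ (λ σ z → 𝟙 (σ ≟ᵗ τ) Q.* z) (typeOf-node t a b) (sym (monomial-* (leaves a) (leaves b) n)) ⟨
      treeGF (node a b) τ n ∎)
    where
    open ≡-Reasoning
    K : Ty t → Ty t → ℚ
    K σ ρ = 𝟙 (combine σ ρ ≟ᵗ τ)
    x^ab : ℚ
    x^ab = (monomial (leaves a) *ₛ monomial (leaves b)) n
    regroup : ∀ σ ρ → K σ ρ Q.* (treeGF a σ *ₛ treeGF b ρ) n
                      ≡ 𝟙 (typeOf t a ≟ᵗ σ) Q.* (𝟙 (typeOf t b ≟ᵗ ρ) Q.* (K σ ρ Q.* x^ab))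
    regroup σ ρ =
      trans (cong (K σ ρ Q.*_) (trans (*ₛ-scalˡ ia (monomial (leaves a)) (treeGF b ρ) n)
                                      (cong (ia Q.*_) (*ₛ-scalʳ ib (monomial (leaves a)) (monomial (leaves b)) n))))
            (solve 4 (λ k x y c → k :* (x :* (y :* c)) := x :* (y :* (k :* c))) refl (K σ ρ) ia ib x^ab)
      where
      ia = 𝟙 (typeOf t a ≟ᵗ σ)
      ib = 𝟙 (typeOf t b ≟ᵗ ρ)

  heightGF-suc : ∀ d τ → heightGF (suc d) τ ≗ Φ (heightGF d) τ
  heightGF-suc d τ n = cong (treeGF leaf τ n Q.+_) (begin
      ∑ (concatMap (λ a → map (node a) H) H) (λ T → treeGF T τ n)
        ≡⟨ ∑-concatMap _ H _ ⟩
      ∑[ a ∈ H ] ∑ (map (node a) H) (λ T → treeGF T τ n)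
        ≡⟨ ∑-cong H (λ a → trans (∑-map (node a) H _) (∑-cong H (λ b → treeGF-node a b τ n))) ⟩
      ∑[ a ∈ H ] ∑[ b ∈ H ] ∑[ σ ∈ types ] ∑[ ρ ∈ types ] (K σ ρ Q.* (treeGF a σ *ₛ treeGF b ρ) n)
        ≡⟨ ∑-cong H (λ a → trans (∑-comm H types _) (∑-cong types (λ σ → ∑-comm H types _))) ⟩
      ∑[ a ∈ H ] ∑[ σ ∈ types ] ∑[ ρ ∈ types ] ∑[ b ∈ H ] (K σ ρ Q.* (treeGF a σ *ₛ treeGF b ρ) n)
        ≡⟨ trans (∑-comm H types _) (∑-cong types (λ σ → ∑-comm H types _)) ⟩
      ∑[ σ ∈ types ] ∑[ ρ ∈ types ] ∑[ a ∈ H ] ∑[ b ∈ H ] (K σ ρ Q.* (treeGF a σ *ₛ treeGF b ρ) n)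
        ≡⟨ ∑-cong types (λ σ → ∑-cong types (λ ρ → ∑-products H H (K σ ρ) (λ a → treeGF a σ) (λ b → treeGF b ρ) n)) ⟩
      ∑[ σ ∈ types ] ∑[ ρ ∈ types ] (K σ ρ Q.* (heightGF d σ *ₛ heightGF d ρ) n) ∎)
    where
    open ≡-Reasoning
    H : List Tree
    H = treesOfHeight≤ d
    K : Ty t → Ty t → ℚ
    K σ ρ = 𝟙 (combine σ ρ ≟ᵗ τ)

  -- No tree has zero leaves.
  heightGF-vanish₀ : ∀ d σ → heightGF d σ 0 ≡ 0ℚ
  heightGF-vanish₀ d σ =
    ∑-zero (treesOfHeight≤ d) (λ T → *-vanishes (𝟙 (typeOf t T ≟ᵗ σ)) (x^k-vanish₀ (leaves-≥1 T)))
    where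
    leaves-≥1 : ∀ T → 1 ℕ.≤ leaves T
    leaves-≥1 leaf = ℕP.≤-refl
    leaves-≥1 (node l r) = ℕP.≤-trans (leaves-≥1 l) (ℕP.m≤m+n (leaves l) (leaves r))
    x^k-vanish₀ : ∀ {k} → 1 ℕ.≤ k → monomial k 0 ≡ 0ℚ
    x^k-vanish₀ (s≤s _) = refl

  Φ-local : ∀ {F G} τ n → (∀ σ → F σ 0 ≡ 0ℚ) → (∀ σ → G σ 0 ≡ 0ℚ) →
    (∀ σ i → i ℕ.< n → F σ i ≡ G σ i) → Φ F τ n ≡ Φ G τ n
  Φ-local {F} {G} τ n F₀ G₀ F≡G = cong (treeGF leaf τ n Q.+_)
    (∑-cong types (λ σ → ∑-cong types (λ ρ → cong (𝟙 (combine σ ρ ≟ᵗ τ) Q.*_)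
      (*ₛ-local₀ n (F₀ σ) (F₀ ρ) (G₀ σ) (G₀ ρ) (F≡G σ) (F≡G ρ)))))

  heightGF-stable : ∀ d τ n → n ℕ.≤ suc d → heightGF (suc d) τ n ≡ heightGF d τ n
  heightGF-stable zero τ n n≤1 = trans (heightGF-suc 0 τ n) (cong (treeGF leaf τ n Q.+_)
    (∑-zero types (λ σ → ∑-zero types (λ ρ → *-vanishes (𝟙 (combine σ ρ ≟ᵗ τ))
      (*ₛ-vanish≤1 (heightGF 0 σ) (heightGF 0 ρ) n (heightGF-vanish₀ 0 σ) (heightGF-vanish₀ 0 ρ) n≤1)))))
  heightGF-stable (suc d) τ n n≤d+2 = begin
      heightGF (suc (suc d)) τ n    ≡⟨ heightGF-suc (suc d) τ n ⟩
      Φ (heightGF (suc d)) τ n      ≡⟨ Φ-local τ n (heightGF-vanish₀ (suc d)) (heightGF-vanish₀ d)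
                                         (λ σ i i<n → heightGF-stable d σ i (ℕP.≤-pred (ℕP.≤-trans i<n n≤d+2))) ⟩
      Φ (heightGF d) τ n            ≡⟨ heightGF-suc d τ n ⟨
      heightGF (suc d) τ n          ∎
    where open ≡-Reasoning

  heightGF-typeGF : ∀ τ m i → i ℕ.≤ m → heightGF m τ i ≡ typeGF τ i
  heightGF-typeGF τ m i i≤m = trans (cong (λ d → heightGF d τ i) (sym (ℕP.m∸n+n≡m i≤m))) (above (m ℕ.∸ i))
    where
    above : ∀ k → heightGF (k ℕ.+ i) τ i ≡ typeGF τ i
    above zero = refl
    above (suc k) = trans (heightGF-stable (k ℕ.+ i) τ i (ℕP.≤-trans (ℕP.m≤n+m i k) (ℕP.n≤1+n _))) (above k)

  typeGF-fix : ∀ τ → typeGF τ ≗ Φ typeGF τ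
  typeGF-fix τ m = begin
      heightGF m τ m          ≡⟨ heightGF-stable m τ m (ℕP.n≤1+n m) ⟨
      heightGF (suc m) τ m    ≡⟨ heightGF-suc m τ m ⟩
      Φ (heightGF m) τ m      ≡⟨ Φ-local τ m (heightGF-vanish₀ m) (λ σ → heightGF-vanish₀ 0 σ)
                                   (λ σ i i<m → heightGF-typeGF σ m i (ℕP.<⇒≤ i<m)) ⟩
      Φ typeGF τ m            ∎
    where open ≡-Reasoning

  av-typeGF : ∀ n → toℚ (av t n) ≡ ∑[ τ ∈ types ] (ι (not (rootBit τ)) Q.* typeGF τ n)
  av-typeGF n = begin
      toℚ (av t n)
        ≡⟨ length-filter (λ T → avoids? T t) (trees n) ⟩
      ∑[ T ∈ trees n ] ι (not (contains T t))
        ≡⟨ ∑-filter (λ T → leaves T ℕ.≟ n) H (λ T → ι (not (contains T t))) ⟩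
      ∑[ T ∈ H ] (monomial (leaves T) n Q.* ι (not (contains T t)))
        ≡⟨ ∑-cong H split-by-type ⟩
      ∑[ T ∈ H ] ∑[ τ ∈ types ] (𝟙 (typeOf t T ≟ᵗ τ) Q.* term T τ)
        ≡⟨ ∑-comm H types (λ T τ → 𝟙 (typeOf t T ≟ᵗ τ) Q.* term T τ) ⟩
      ∑[ τ ∈ types ] ∑[ T ∈ H ] (𝟙 (typeOf t T ≟ᵗ τ) Q.* term T τ)
        ≡⟨ ∑-cong types (λ τ → trans (∑-cong H (regroup τ))
                                     (∑-scal H (ι (not (rootBit τ))) (λ T → treeGF T τ n))) ⟩
      ∑[ τ ∈ types ] (ι (not (rootBit τ)) Q.* typeGF τ n) ∎
    where
    open ≡-Reasoning
    H : List Tree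
    H = treesOfHeight≤ n
    term : Tree → Ty t → ℚ
    term T τ = ι (not (rootBit τ)) Q.* monomial (leaves T) n
    split-by-type : ∀ T → monomial (leaves T) n Q.* ι (not (contains T t))
      ≡ ∑[ τ ∈ types ] (𝟙 (typeOf t T ≟ᵗ τ) Q.* term T τ)
    split-by-type T = sym (begin
      ∑[ τ ∈ types ] (𝟙 (typeOf t T ≟ᵗ τ) Q.* term T τ)     ≡⟨ ∑-pick t (typeOf t T) (term T) ⟩
      ι (not (rootBit (typeOf t T))) Q.* monomial (leaves T) n
                                       ≡⟨ cong (λ b → ι (not b) Q.* monomial (leaves T) n) (rootBit-typeOf t T) ⟩
      ι (not (contains T t)) Q.* monomial (leaves T) n    ≡⟨ QP.*-comm (ι (not (contains T t))) (monomial (leaves T) n) ⟩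
      monomial (leaves T) n Q.* ι (not (contains T t))    ∎)
    regroup : ∀ τ T → 𝟙 (typeOf t T ≟ᵗ τ) Q.* term T τ ≡ ι (not (rootBit τ)) Q.* treeGF T τ n
    regroup τ T = solve 3 (λ x y z → x :* (y :* z) := y :* (x :* z)) refl
      (𝟙 (typeOf t T ≟ᵗ τ)) (ι (not (rootBit τ))) (monomial (leaves T) n)

  module Decomposition (τ : Ty t) where

    joins : Ty t → Ty t → ℚ
    joins σ ρ = 𝟙 (combine σ ρ ≟ᵗ τ)

    -- a pair with exactly one entry equal to τ contributes typeGF τ times this
    linearPart : (σ ρ : Ty t) → Dec (σ ≡ τ) → Dec (ρ ≡ τ) → Series
    linearPart σ ρ (yes _) (yes _) = 0ₛ
    linearPart σ ρ (yes _) (no _) = joins σ ρ ·ₛ typeGF ρ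
    linearPart σ ρ (no _) (yes _) = joins σ ρ ·ₛ typeGF σ
    linearPart σ ρ (no _) (no _) = 0ₛ

    -- a pair with no entry equal to τ contributes this
    otherPart : (σ ρ : Ty t) → Dec (σ ≡ τ) → Dec (ρ ≡ τ) → Series
    otherPart σ ρ (no _) (no _) = joins σ ρ ·ₛ (typeGF σ *ₛ typeGF ρ)
    otherPart σ ρ (yes _) _ = 0ₛ
    otherPart σ ρ (no _) (yes _) = 0ₛ

    Linear : Series
    Linear = ∑ₛ types (λ σ → ∑ₛ types (λ ρ → linearPart σ ρ (σ ≟ᵗ τ) (ρ ≟ᵗ τ)))

    Other : Series
    Other = ∑ₛ types (λ σ → ∑ₛ types (λ ρ → otherPart σ ρ (σ ≟ᵗ τ) (ρ ≟ᵗ τ)))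

    -- (the pair (τ, τ) contributes nothing, by combine-self)
    split-summand : rootBit τ ≡ false → ∀ σ ρ dσ dρ →
      joins σ ρ ·ₛ (typeGF σ *ₛ typeGF ρ) ≗ typeGF τ *ₛ linearPart σ ρ dσ dρ +ₛ otherPart σ ρ dσ dρ
    split-summand root≡false σ ρ (yes refl) (yes refl) n = begin
        joins τ τ Q.* (typeGF τ *ₛ typeGF τ) n
          ≡⟨ cong (λ b → ι b Q.* (typeGF τ *ₛ typeGF τ) n)
                  (dec-false (combine τ τ ≟ᵗ τ) (combine-self τ root≡false)) ⟩
        0ℚ Q.* (typeGF τ *ₛ typeGF τ) n
          ≡⟨ QP.*-zeroˡ ((typeGF τ *ₛ typeGF τ) n) ⟩
        0ℚ
          ≡⟨ *ₛ-zeroʳ (typeGF τ) (λ _ → refl) n ⟨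
        (typeGF τ *ₛ 0ₛ) n
          ≡⟨ QP.+-identityʳ ((typeGF τ *ₛ 0ₛ) n) ⟨
        (typeGF τ *ₛ 0ₛ) n Q.+ 0ℚ ∎
      where open ≡-Reasoning
    split-summand _ σ ρ (yes refl) (no _) n =
      trans (sym (*ₛ-scalʳ (joins σ ρ) (typeGF τ) (typeGF ρ) n))
            (sym (QP.+-identityʳ ((typeGF τ *ₛ (joins σ ρ ·ₛ typeGF ρ)) n)))
    split-summand _ σ ρ (no _) (yes refl) n =
      trans (cong (joins σ ρ Q.*_) (*ₛ-comm (typeGF σ) (typeGF τ) n))
        (trans (sym (*ₛ-scalʳ (joins σ ρ) (typeGF τ) (typeGF σ) n))
               (sym (QP.+-identityʳ ((typeGF τ *ₛ (joins σ ρ ·ₛ typeGF σ)) n))))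
    split-summand _ σ ρ (no _) (no _) n =
      sym (trans (cong (Q._+ (joins σ ρ ·ₛ (typeGF σ *ₛ typeGF ρ)) n) (*ₛ-zeroʳ (typeGF τ) (λ _ → refl) n))
                 (QP.+-identityˡ ((joins σ ρ ·ₛ (typeGF σ *ₛ typeGF ρ)) n)))

    typeGF-linear : rootBit τ ≡ false → typeGF τ ≗ (treeGF leaf τ +ₛ Other) +ₛ typeGF τ *ₛ Linear
    typeGF-linear root≡false n = begin
        typeGF τ n
          ≡⟨ typeGF-fix τ n ⟩
        treeGF leaf τ n Q.+ ∑[ σ ∈ types ] ∑[ ρ ∈ types ] (joins σ ρ ·ₛ (typeGF σ *ₛ typeGF ρ)) n
          ≡⟨ cong (treeGF leaf τ n Q.+_) (∑-cong types (λ σ → ∑-cong types (λ ρ →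
               split-summand root≡false σ ρ (σ ≟ᵗ τ) (ρ ≟ᵗ τ) n))) ⟩
        treeGF leaf τ n Q.+ ∑[ σ ∈ types ] ∑[ ρ ∈ types ] ((typeGF τ *ₛ lin σ ρ) n Q.+ oth σ ρ n)
          ≡⟨ cong (treeGF leaf τ n Q.+_) (trans (∑-cong types (λ σ → ∑-+ types (λ ρ → (typeGF τ *ₛ lin σ ρ) n) (λ ρ → oth σ ρ n)))
                                                 (∑-+ types (λ σ → ∑[ ρ ∈ types ] (typeGF τ *ₛ lin σ ρ) n) (λ σ → ∑[ ρ ∈ types ] oth σ ρ n))) ⟩
        treeGF leaf τ n Q.+ (∑[ σ ∈ types ] ∑[ ρ ∈ types ] (typeGF τ *ₛ lin σ ρ) n Q.+ Other n)
          ≡⟨ cong (λ z → treeGF leaf τ n Q.+ (z Q.+ Other n)) (sym pull-out) ⟩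
        treeGF leaf τ n Q.+ ((typeGF τ *ₛ Linear) n Q.+ Other n)
          ≡⟨ solve 3 (λ l c o → l :+ (c :+ o) := (l :+ o) :+ c) refl (treeGF leaf τ n) ((typeGF τ *ₛ Linear) n) (Other n) ⟩
        (treeGF leaf τ n Q.+ Other n) Q.+ (typeGF τ *ₛ Linear) n ∎
      where
      open ≡-Reasoning
      lin oth : Ty t → Ty t → Series
      lin σ ρ = linearPart σ ρ (σ ≟ᵗ τ) (ρ ≟ᵗ τ)
      oth σ ρ = otherPart σ ρ (σ ≟ᵗ τ) (ρ ≟ᵗ τ)
      pull-out : (typeGF τ *ₛ Linear) n ≡ ∑[ σ ∈ types ] ∑[ ρ ∈ types ] (typeGF τ *ₛ lin σ ρ) n
      pull-out = trans (*ₛ-∑ʳ types (typeGF τ) _ n) (∑-cong types (λ σ → *ₛ-∑ʳ types (typeGF τ) _ n))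

    -- Linear has no constant term, since no tree has zero leaves.
    Linear₀ : Linear 0 ≡ 0ℚ
    Linear₀ = ∑-zero types (λ σ → ∑-zero types (λ ρ → vanish σ ρ (σ ≟ᵗ τ) (ρ ≟ᵗ τ)))
      where
      vanish : ∀ σ ρ dσ dρ → linearPart σ ρ dσ dρ 0 ≡ 0ℚ
      vanish σ ρ (yes _) (yes _) = refl
      vanish σ ρ (yes _) (no _) = *-vanishes (joins σ ρ) (heightGF-vanish₀ 0 ρ)
      vanish σ ρ (no _) (yes _) = *-vanishes (joins σ ρ) (heightGF-vanish₀ 0 σ)
      vanish σ ρ (no _) (no _) = refl

    module _ (smaller : ∀ σ → σ ≤ᵗ τ → σ ≢ τ → Rational (typeGF σ)) where

      rational-Linear : Rational Linear
      rational-Linear = rational-∑ types _ (λ σ → rational-∑ types _ (λ ρ → part σ ρ (σ ≟ᵗ τ) (ρ ≟ᵗ τ)))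
        where
        part : ∀ σ ρ dσ dρ → Rational (linearPart σ ρ dσ dρ)
        part σ ρ (yes _) (yes _) = rational-0
        part σ ρ (yes _) (no ρ≢τ) = rational-𝟙 (combine σ ρ ≟ᵗ τ) (λ c≡τ → smaller ρ (proj₂ (combine-below c≡τ)) ρ≢τ)
        part σ ρ (no σ≢τ) (yes _) = rational-𝟙 (combine σ ρ ≟ᵗ τ) (λ c≡τ → smaller σ (proj₁ (combine-below c≡τ)) σ≢τ)
        part σ ρ (no _) (no _) = rational-0

      rational-Other : Rational Other
      rational-Other = rational-∑ types _ (λ σ → rational-∑ types _ (λ ρ → part σ ρ (σ ≟ᵗ τ) (ρ ≟ᵗ τ)))
        where
        part : ∀ σ ρ dσ dρ → Rational (otherPart σ ρ dσ dρ)
        part σ ρ (no σ≢τ) (no ρ≢τ) = rational-𝟙 (combine σ ρ ≟ᵗ τ) (λ c≡τ →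
          rational-* (smaller σ (proj₁ (combine-below c≡τ)) σ≢τ) (smaller ρ (proj₂ (combine-below c≡τ)) ρ≢τ))
        part σ ρ (yes _) _ = rational-0
        part σ ρ (no _) (yes _) = rational-0

  rational-treeGF-leaf : ∀ τ → Rational (treeGF leaf τ)
  rational-treeGF-leaf τ = rational-𝟙 (typeOf t leaf ≟ᵗ τ) (λ _ → rational-poly (polynomial-monomial 1))

  rational-typeGF : ∀ fuel τ → weight τ ℕ.< fuel → rootBit τ ≡ false → Rational (typeGF τ)
  rational-typeGF (suc fuel) τ w<fuel root≡false =
    rational-fix (rational-+ (rational-treeGF-leaf τ) (rational-Other smaller)) (rational-Linear smaller)
      Linear₀ (typeGF-linear root≡false)
    where
    open Decomposition τ
    smaller : ∀ σ → σ ≤ᵗ τ → σ ≢ τ → Rational (typeGF σ)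
    smaller σ σ≤τ σ≢τ = rational-typeGF fuel σ (ℕP.<-≤-trans (weight-< σ≤τ σ≢τ) (ℕP.≤-pred w<fuel))
      (≤ᵗ-rootBit σ≤τ root≡false)

  rational-avoiders : Rational (∑ₛ types (λ τ → ι (not (rootBit τ)) ·ₛ typeGF τ))
  rational-avoiders = rational-∑ types _ (λ τ → rational-ι (not (rootBit τ)) (avoiding τ))
    where
    avoiding : ∀ τ → not (rootBit τ) ≡ true → Rational (typeGF τ)
    avoiding τ e = rational-typeGF (suc (weight τ)) τ ℕP.≤-refl (root≡false (rootBit τ) e)
      where
      root≡false : ∀ b → not b ≡ true → b ≡ false
      root≡false false _ = refl

proposition2 : ∀ (t : Tree) → IsRationalGF (av t)
proposition2 t = toIsRationalGF (av t) (rational-cong (λ n → sym (av-typeGF n)) rational-avoiders)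
  where open Counting t
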